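{- Let $n \geq 4$ be an integer and let $P_n$ be the poset obtained from two disjoint copies of the butterfly poset $T_n$ by identifying their two minimal elements with each other and their two maximal elements with each other. Then $P_n$ does not have an $R$-labeling.
   Context: For a finite poset $P$, write $x \prec y$ if $y$ covers $x$, and let $E(P) = \{(x,y) \in P^2 : x \prec y\}$ be the set of cover relations. An interval $[x,y]$ is non-trivial if $x < y$. An $R$-labeling of $P$ consists of a set $\Lambda$ together with an arbitrary binary relation $\sim$ on $\Lambda$ and a function $\lambda : E(P) \to \Lambda$ such that in every non-trivial interval $[x,y]$ of $P$ there is a unique maximal chain $x = x_0 \prec x_1 \prec \cdots \prec x_k = y$ with $\lambda(x_0,x_1) \sim \lambda(x_1,x_2) \sim \cdots \sim \lambda(x_{k-1},x_k)$ (i.e. $\lambda(x_{i-1},x_i) \sim \lambda(x_i,x_{i+1})$ for all $1 \le i \le k-1$). The butterfly poset $T_n$ is the unique graded poset of rank $n$ (with minimum $\hat 0$ of rank $0$ and maximum $\hat 1$ of rank $n$) having exactly two elements of rank $i$ for each $1 \leq i \leq n-1$, and in which every element other than $\hat{0}$ covers all elements of rank one less than its own rank. -}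

module Defs where

open import Level using (Level; suc; _⊔_)
open import Data.Bool using (Bool)
open import Data.Nat using (ℕ; _<_; _∸_)
open import Data.Fin using (Fin; toℕ)
open import Data.List using (List; []; _∷_)
open import Data.Product using (Σ; Σ-syntax; _×_; ∃-syntax)
open import Data.Sum using (_⊎_)
open import Data.Unit using (⊤)
open import Data.Empty using (⊥)
open import Relation.Nullary using (¬_)
open import Relation.Binary.PropositionalEquality using (_≡_; _≢_)

module _ {c r : Level} {C : Set c} (_≤_ : C → C → Set r) where

  Covers : C → C → Set (c ⊔ r)
  Covers x y = (x ≤ y × x ≢ y) × (∀ z → x ≤ z → z ≤ y → z ≡ x ⊎ z ≡ y)

  -- IsMaxChain x zs y : x = x₀ ≺ x₁ ≺ ⋯ ≺ xₖ = y where zs = [x₁, …, xₖ]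
  IsMaxChain : C → List C → C → Set (c ⊔ r)
  IsMaxChain x []       y = Level.Lift (c ⊔ r) (x ≡ y)
  IsMaxChain x (z ∷ zs) y = Covers x z × IsMaxChain z zs y

  Rising : ∀ {a b} {Λ : Set a} → (_∼_ : Λ → Λ → Set b) → (C → C → Λ) →
           C → List C → Set b
  Rising _∼_ lab x []           = Level.Lift _ ⊤
  Rising _∼_ lab x (y ∷ [])     = Level.Lift _ ⊤
  Rising _∼_ lab x (y ∷ z ∷ zs) = lab x y ∼ lab y z × Rising _∼_ lab y (z ∷ zs)

  -- An R-labeling with label set Λ, relation _∼_ and labeling lab.
  -- (lab is given on all pairs; only its values on cover pairs matter.)
  IsRLabeling : ∀ {a b} {Λ : Set a} → (Λ → Λ → Set b) → (C → C → Λ) →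
                Set (c ⊔ r ⊔ b)
  IsRLabeling _∼_ lab =
    ∀ x y → x ≤ y → x ≢ y →
      Σ[ zs ∈ List C ] ((IsMaxChain x zs y × Rising _∼_ lab x zs) ×
        (∀ ws → IsMaxChain x ws y → Rising _∼_ lab x ws → ws ≡ zs))

  HasRLabeling : (a b : Level) → Set (c ⊔ r ⊔ suc a ⊔ suc b)
  HasRLabeling a b =
    Σ[ Λ ∈ Set a ] Σ[ rel ∈ (Λ → Λ → Set b) ] Σ[ lab ∈ (C → C → Λ) ]
      IsRLabeling rel lab

-- The poset P_n: two copies of the butterfly T_n glued at 0̂ and 1̂.
-- mid c s i is the element of copy c, side s, of rank toℕ i + 1
-- (so ranks 1 … n-1).

data PElem (n : ℕ) : Set where
  bot : PElem n
  top : PElem n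
  mid : (copy side : Bool) → (i : Fin (n ∸ 1)) → PElem n

-- In T_n, x < y iff rank x < rank y; the two copies are glued only at
-- 0̂ and 1̂, so middle elements of different copies are incomparable.
_≤P_ : ∀ {n} → PElem n → PElem n → Set
bot ≤P _ = ⊤
top ≤P top = ⊤
top ≤P bot = ⊥
top ≤P mid _ _ _ = ⊥
mid _ _ _ ≤P bot = ⊥
mid _ _ _ ≤P top = ⊤
mid c s i ≤P mid c' s' j = c ≡ c' × (toℕ i < toℕ j ⊎ (i ≡ j × s ≡ s'))

-- Fix one copy of T_n and let X s, Y t (s, t ∈ Bool) be its elements of ranks n − 2 and n − 1.
-- The interval [X s, 1̂] is X s ≺ Y t ≺ 1̂ for both t, so it singles out one side g s; the
-- rising chain of [0̂, X s] arrives at X s from some q s of rank n − 3 ≥ 1 in the same copy.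
-- If q s ≺ X s ≺ Y (g s) rises for some s, gluing gives a rising maximal chain of [0̂, 1̂]
-- through this copy; as this happens in both copies, [0̂, 1̂] has two rising chains.
-- Otherwise the rising chain of [0̂, Y (g false)] enters through some X s, and its prefix is the
-- rising chain of [0̂, X s], so s = true and q true ≺ X true ≺ Y (g false) rises; the rising
-- chain of [q true, 1̂] is q true ≺ X s ≺ Y (g s) ≺ 1̂ with s ≠ true, so [q true, Y (g false)]
-- has the two rising chains through X true and X false.  Since the labels' relation is
-- arbitrary this dichotomy is not decidable, so each copy yields its rising chain only under
-- ¬ ¬, which suffices.

module Submission where

open import Defs
open import Level using (Level; lift; _⊔_)
open import Data.Unit using (tt)
open import Data.Empty using (⊥)
open import Data.Nat using (ℕ; suc; _≤_; _<_; s≤s; z≤n)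
open import Data.Nat.Properties
  using ( n≤1+n; ≤-refl; ≤-trans; ≤-pred; ≤-reflexive; ≤-antisym; 1+n≰n
        ; <⇒≤; <⇒≢; <-irrefl; ≤∧≢⇒<; suc-injective; _≟_)
open import Data.Fin using (Fin; toℕ; fromℕ<; zero)
open import Data.Fin.Properties using (toℕ<n; toℕ-fromℕ<; toℕ-injective)
open import Data.List using (List; []; _∷_; _∷ʳ_; [_])
open import Data.List.Properties using (∷ʳ-injectiveˡ)
open import Data.Product using (Σ-syntax; _×_; _,_; proj₁; proj₂)
open import Data.Sum using (_⊎_; inj₁; inj₂)
open import Relation.Nullary using (¬_; yes; no; contradiction)
open import Data.Bool using (Bool; true; false)
open import Function using (_∘_)
open import Relation.Binary.PropositionalEquality
  using (_≡_; _≢_; refl; sym; trans; cong; subst; subst₂)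

module Graded {c r} {C : Set c} (_⊑_ : C → C → Set r) (rank : C → ℕ)
  (rank-mono : ∀ {x y} → x ⊑ y → rank x ≤ rank y)
  (rank-injective : ∀ {x y} → x ⊑ y → rank x ≡ rank y → x ≡ y)
  (interpolate : ∀ {x y} → x ⊑ y → suc (rank x) < rank y →
                 Σ[ z ∈ C ] (x ⊑ z × z ⊑ y) × (rank x < rank z × rank z < rank y))
  where

  rank-strict : ∀ {x y} → x ⊑ y → x ≢ y → rank x < rank y
  rank-strict x⊑y x≢y = ≤∧≢⇒< (rank-mono x⊑y) (λ eq → x≢y (rank-injective x⊑y eq))

  covers⇒rank-suc : ∀ {x y} → Covers _⊑_ x y → rank y ≡ suc (rank x)
  covers⇒rank-suc {x} {y} ((x⊑y , x≢y) , between) with suc (rank x) ≟ rank y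
  ... | yes eq = sym eq
  ... | no neq with interpolate x⊑y (≤∧≢⇒< (rank-strict x⊑y x≢y) neq)
  ...   | z , (x⊑z , z⊑y) , (x<z , z<y) with between z x⊑z z⊑y
  ...     | inj₁ refl = contradiction x<z (<-irrefl refl)
  ...     | inj₂ refl = contradiction z<y (<-irrefl refl)

  rank-suc⇒covers : ∀ {x y} → x ⊑ y → rank y ≡ suc (rank x) → Covers _⊑_ x y
  rank-suc⇒covers {x} {y} x⊑y eq = (x⊑y , x≢y) , between
    where
    x≢y : x ≢ y
    x≢y refl = <-irrefl eq (s≤s (rank-mono x⊑y))
    between : ∀ z → x ⊑ z → z ⊑ y → z ≡ x ⊎ z ≡ y
    between z x⊑z z⊑y with rank x ≟ rank z
    ... | yes same = inj₁ (sym (rank-injective x⊑z same))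
    ... | no differ = inj₂ (rank-injective z⊑y
            (≤-antisym (rank-mono z⊑y) (subst (_≤ rank z) (sym eq) (≤∧≢⇒< (rank-mono x⊑z) differ))))

module RisingChains {c r} {C : Set c} (_⊑_ : C → C → Set r)
  {ℓ ℓ′} {Λ : Set ℓ} (_∼_ : Λ → Λ → Set ℓ′) (lab : C → C → Λ) where

  Rises : C → C → C → Set ℓ′
  Rises x y z = lab x y ∼ lab y z

  IsMaxChain-endpoint : ∀ {a b b′} zs → IsMaxChain _⊑_ a zs b → IsMaxChain _⊑_ a zs b′ → b ≡ b′
  IsMaxChain-endpoint []       (lift a≡b) (lift a≡b′) = trans (sym a≡b) a≡b′
  IsMaxChain-endpoint (_ ∷ zs) (_ , ch)   (_ , ch′)   = IsMaxChain-endpoint zs ch ch′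

  IsMaxChain-∷ʳ : ∀ {a b d} zs → IsMaxChain _⊑_ a zs b → Covers _⊑_ b d →
    IsMaxChain _⊑_ a (zs ∷ʳ d) d
  IsMaxChain-∷ʳ []       (lift refl) b≺d = b≺d , lift refl
  IsMaxChain-∷ʳ (_ ∷ zs) (a≺z , ch)  b≺d = a≺z , IsMaxChain-∷ʳ zs ch b≺d

  IsMaxChain-unsnoc : ∀ {a b} z zs → IsMaxChain _⊑_ a (z ∷ zs) b →
    Σ[ pre ∈ List C ] Σ[ p ∈ C ] z ∷ zs ≡ pre ∷ʳ b × IsMaxChain _⊑_ a pre p × Covers _⊑_ p b
  IsMaxChain-unsnoc z []       (a≺z , lift refl) = [] , _ , refl , lift refl , a≺z
  IsMaxChain-unsnoc z (w ∷ ws) (a≺z , ch) with IsMaxChain-unsnoc w ws ch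
  ... | pre , p , eq , ch′ , p≺b = z ∷ pre , p , cong (z ∷_) eq , (a≺z , ch′) , p≺b

  Rising-∷ʳ : ∀ {a p b d} pre → IsMaxChain _⊑_ a pre p →
    Rising _⊑_ _∼_ lab a (pre ∷ʳ b) → Rises p b d → Rising _⊑_ _∼_ lab a (pre ∷ʳ b ∷ʳ d)
  Rising-∷ʳ []           (lift refl)       _         pbd = pbd , lift tt
  Rising-∷ʳ (_ ∷ [])     (_ , lift refl)   (r , _)   pbd = r , pbd , lift tt
  Rising-∷ʳ (_ ∷ v ∷ vs) (_ , ch)          (r , rs)  pbd = r , Rising-∷ʳ (v ∷ vs) ch rs pbd

  Rising-∷ʳ⁻ : ∀ {a p b d} pre → IsMaxChain _⊑_ a pre p →
    Rising _⊑_ _∼_ lab a (pre ∷ʳ b ∷ʳ d) → Rising _⊑_ _∼_ lab a (pre ∷ʳ b) × Rises p b d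
  Rising-∷ʳ⁻ []           (lift refl)     (pbd , _)      = lift tt , pbd
  Rising-∷ʳ⁻ (_ ∷ [])     (_ , lift refl) (r , pbd , _)  = (r , lift tt) , pbd
  Rising-∷ʳ⁻ (_ ∷ v ∷ vs) (_ , ch)        (r , rs)       with Rising-∷ʳ⁻ (v ∷ vs) ch rs
  ... | rs′ , pbd = (r , rs′) , pbd

  RisingVia : C → C → C → Set (c ⊔ r ⊔ ℓ′)
  RisingVia a p b = Σ[ pre ∈ List C ]
    IsMaxChain _⊑_ a pre p × Covers _⊑_ p b × Rising _⊑_ _∼_ lab a (pre ∷ʳ b)

  RisingVia⇒Covers : ∀ {a p b} → RisingVia a p b → Covers _⊑_ p b
  RisingVia⇒Covers (_ , _ , p≺b , _) = p≺b

  RisingVia-twoStep : ∀ {a u b} → Covers _⊑_ a u → Covers _⊑_ u b → Rises a u b → RisingVia a u b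
  RisingVia-twoStep a≺u u≺b aub = [ _ ] , (a≺u , lift refl) , u≺b , aub , lift tt

  RisingVia-extend : ∀ {a p b d} → RisingVia a p b → Covers _⊑_ b d → Rises p b d → RisingVia a b d
  RisingVia-extend (pre , ch , p≺b , rs) b≺d pbd =
    pre ∷ʳ _ , IsMaxChain-∷ʳ pre ch p≺b , b≺d , Rising-∷ʳ pre ch rs pbd

  RisingVia-restrict : ∀ {a b d} → RisingVia a b d → a ≢ b →
    Σ[ p ∈ C ] RisingVia a p b × Rises p b d
  RisingVia-restrict ([] , lift a≡b , _) a≢b = contradiction a≡b a≢b
  RisingVia-restrict {a} {d = d} (z ∷ zs , ch , b≺d , rs) _ with IsMaxChain-unsnoc z zs ch
  ... | pre , p , eq , ch′ , p≺b
    with Rising-∷ʳ⁻ pre ch′ (subst (λ l → Rising _⊑_ _∼_ lab a (l ∷ʳ d)) eq rs)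
  ...   | rs′ , pbd = p , (pre , ch′ , p≺b , rs′) , pbd

  module _ (R : IsRLabeling _⊑_ _∼_ lab) where

    RisingVia-exists : ∀ {a b} → a ⊑ b → a ≢ b → Σ[ p ∈ C ] RisingVia a p b
    RisingVia-exists {a} {b} a⊑b a≢b with R a b a⊑b a≢b
    ... | [] , (lift a≡b , _) , _ = contradiction a≡b a≢b
    ... | z ∷ zs , (ch , rs) , _ with IsMaxChain-unsnoc z zs ch
    ...   | pre , p , eq , ch′ , p≺b =
            p , pre , ch′ , p≺b , subst (Rising _⊑_ _∼_ lab a) eq rs

    RisingVia-unique : ∀ {a p p′ b} → a ⊑ b → a ≢ b → RisingVia a p b → RisingVia a p′ b → p ≡ p′
    RisingVia-unique {b = b} a⊑b a≢b (pre , ch , p≺b , rs) (pre′ , ch′ , p′≺b , rs′)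
      with R _ b a⊑b a≢b
    ... | _ , _ , unique =
      IsMaxChain-endpoint pre ch (subst (λ l → IsMaxChain _⊑_ _ l _) (sym pre≡pre′) ch′)
      where
      pre≡pre′ : pre ≡ pre′
      pre≡pre′ = ∷ʳ-injectiveˡ pre pre′ (trans (unique _ (IsMaxChain-∷ʳ pre ch p≺b) rs)
                                         (sym (unique _ (IsMaxChain-∷ʳ pre′ ch′ p′≺b) rs′)))

module Butterflies (m : ℕ) where

  N K : ℕ
  N = suc (suc (suc (suc m)))
  K = suc (suc (suc m))

  P : Set
  P = PElem N

  _⊑_ : P → P → Set
  _⊑_ = _≤P_ {N}

  rank : P → ℕ
  rank bot           = 0
  rank top           = N
  rank (mid _ _ i)   = suc (toℕ i)

  ⊑-top : ∀ x → x ⊑ top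
  ⊑-top bot         = tt
  ⊑-top top         = tt
  ⊑-top (mid _ _ _) = tt

  rank-mono : ∀ {x y} → x ⊑ y → rank x ≤ rank y
  rank-mono {bot}                         _                  = z≤n
  rank-mono {top}       {top}             _                  = ≤-refl
  rank-mono {mid _ _ i} {top}             _                  = <⇒≤ (s≤s (toℕ<n i))
  rank-mono {mid _ _ _} {mid _ _ _}       (refl , inj₁ i<j)  = s≤s (<⇒≤ i<j)
  rank-mono {mid _ _ _} {mid _ _ _}       (refl , inj₂ (refl , refl)) = ≤-refl

  rank-injective : ∀ {x y} → x ⊑ y → rank x ≡ rank y → x ≡ y
  rank-injective {bot}       {bot}       _ _  = refl
  rank-injective {top}       {top}       _ _  = refl
  rank-injective {mid _ _ i} {top}       _ eq = contradiction (suc-injective eq) (<⇒≢ (toℕ<n i))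
  rank-injective {mid _ _ _} {mid _ _ _} (refl , inj₁ i<j) eq =
    contradiction (suc-injective eq) (<⇒≢ i<j)
  rank-injective {mid _ _ _} {mid _ _ _} (refl , inj₂ (refl , refl)) _ = refl

  interpolate-above : ∀ c s (i : Fin K) y → mid c s i ⊑ y → suc (suc (toℕ i)) < rank y →
    Σ[ z ∈ P ] (mid c s i ⊑ z × z ⊑ y) × (suc (toℕ i) < rank z × rank z < rank y)
  interpolate-above c s i y i⊑y gap = mid c s j , (i⊑j , j⊑y y i⊑y j<y) , (s≤s i<j , j<y)
    where
    i+1<K : suc (toℕ i) < K
    i+1<K = ≤-pred (≤-trans gap (rank-mono (⊑-top y)))
    j : Fin K
    j = fromℕ< i+1<K
    j≡i+1 : toℕ j ≡ suc (toℕ i)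
    j≡i+1 = toℕ-fromℕ< i+1<K
    i<j : toℕ i < toℕ j
    i<j = ≤-reflexive (sym j≡i+1)
    i⊑j : mid c s i ⊑ mid c s j
    i⊑j = refl , inj₁ i<j
    j<y : suc (toℕ j) < rank y
    j<y = subst (λ k → suc k < rank y) (sym j≡i+1) gap
    j⊑y : ∀ w → mid c s i ⊑ w → suc (toℕ j) < rank w → mid c s j ⊑ w
    j⊑y top         _          _   = tt
    j⊑y (mid _ _ _) (refl , _) j<w = refl , inj₁ (≤-pred j<w)

  interpolate : ∀ {x y} → x ⊑ y → suc (rank x) < rank y →
    Σ[ z ∈ P ] (x ⊑ z × z ⊑ y) × (rank x < rank z × rank z < rank y)
  interpolate {bot}       {bot}       _   ()
  interpolate {bot}       {top}       _   _          =
    mid true true zero , (tt , tt) , (s≤s z≤n , s≤s (s≤s z≤n))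
  interpolate {bot}       {mid c s j} _   (s≤s 0<j)  =
    mid c s zero , (tt , (refl , inj₁ 0<j)) , (s≤s z≤n , s≤s 0<j)
  interpolate {top}       {top}       _   gap        = contradiction (<⇒≤ gap) 1+n≰n
  interpolate {mid c s i} {y}         i⊑y gap        = interpolate-above c s i y i⊑y gap

  open Graded _⊑_ rank rank-mono rank-injective interpolate

  mid-≢ : ∀ {c c′ s s′} {i j : Fin K} → toℕ i ≢ toℕ j → mid {N} c s i ≢ mid c′ s′ j
  mid-≢ i≢j refl = i≢j refl

  side-injective : ∀ {c s s′} {i : Fin K} → mid {N} c s i ≡ mid c s′ i → s ≡ s′
  side-injective refl = refl

  mid-covers : ∀ {c s t} {i j : Fin K} → toℕ j ≡ suc (toℕ i) → Covers _⊑_ (mid c s i) (mid c t j)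
  mid-covers j≡i+1 = rank-suc⇒covers (refl , inj₁ (≤-reflexive (sym j≡i+1))) (cong suc j≡i+1)

  last-covers-top : ∀ {c s} {i : Fin K} → toℕ i ≡ suc (suc m) → Covers _⊑_ (mid c s i) top
  last-covers-top i≡m+2 = rank-suc⇒covers tt (cong (suc ∘ suc) (sym i≡m+2))

  top-covers-nothing : ∀ {y} → ¬ Covers _⊑_ top y
  top-covers-nothing {top} ((_ , top≢top) , _) = top≢top refl

  covered-mid : ∀ {c s z k} {j : Fin K} → Covers _⊑_ z (mid c s j) → toℕ j ≡ suc k →
    Σ[ t ∈ Bool ] Σ[ i ∈ Fin K ] z ≡ mid c t i × toℕ i ≡ k
  covered-mid {z = bot} z≺j j≡k+1 =
    contradiction (trans (sym j≡k+1) (suc-injective (covers⇒rank-suc z≺j))) λ ()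
  covered-mid {z = mid _ t i} z≺j@(((refl , _) , _) , _) j≡k+1 =
    t , i , refl , suc-injective (trans (sym (suc-injective (covers⇒rank-suc z≺j))) j≡k+1)

  covering-mid : ∀ {c s y k} {i : Fin K} → Covers _⊑_ (mid c s i) y → toℕ i ≡ k → suc k < K →
    Σ[ t ∈ Bool ] Σ[ j ∈ Fin K ] y ≡ mid c t j × toℕ j ≡ suc k
  covering-mid {y = top} {i = i} i≺y i≡k k+1<K =
    contradiction (cong suc (trans (sym i≡k) i≡m+2)) (<⇒≢ k+1<K)
    where
    i≡m+2 : toℕ i ≡ suc (suc m)
    i≡m+2 = sym (suc-injective (suc-injective (covers⇒rank-suc i≺y)))
  covering-mid {y = mid _ t j} i≺y@(((refl , _) , _) , _) i≡k _ =
    t , j , refl , trans (suc-injective (covers⇒rank-suc i≺y)) (cong suc i≡k)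

  covering-last : ∀ {c s y} {i : Fin K} → Covers _⊑_ (mid c s i) y → toℕ i ≡ suc (suc m) → y ≡ top
  covering-last {y = top} _ _ = refl
  covering-last {y = mid _ _ j} i≺y@(((refl , _) , _) , _) i≡m+2 =
    contradiction (trans (suc-injective (covers⇒rank-suc i≺y)) (cong suc i≡m+2)) (<⇒≢ (toℕ<n j))

  iX iY : Fin K
  iX = fromℕ< {suc m} (s≤s (s≤s (n≤1+n m)))
  iY = fromℕ< {suc (suc m)} ≤-refl

  iX≡m+1 : toℕ iX ≡ suc m
  iX≡m+1 = toℕ-fromℕ< (s≤s (s≤s (n≤1+n m)))

  iY≡m+2 : toℕ iY ≡ suc (suc m)
  iY≡m+2 = toℕ-fromℕ< {suc (suc m)} {K} ≤-refl

  iY≡iX+1 : toℕ iY ≡ suc (toℕ iX)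
  iY≡iX+1 = trans iY≡m+2 (cong suc (sym iX≡m+1))

  module RLabeled {ℓ ℓ′} {Λ : Set ℓ} (_∼_ : Λ → Λ → Set ℓ′) (lab : P → P → Λ)
                  (R : IsRLabeling _⊑_ _∼_ lab) where

    open RisingChains _⊑_ _∼_ lab

    module Copy (c : Bool) where

      X Y : Bool → P
      X s = mid c s iX
      Y t = mid c t iY

      X≺Y : ∀ {s t} → Covers _⊑_ (X s) (Y t)
      X≺Y = mid-covers iY≡iX+1

      Y≺top : ∀ {t} → Covers _⊑_ (Y t) top
      Y≺top = last-covers-top iY≡m+2

      chain-top-top : ∀ zs → IsMaxChain _⊑_ top zs top → zs ≡ []
      chain-top-top []      _           = refl
      chain-top-top (_ ∷ _) (top≺w , _) = contradiction top≺w top-covers-nothing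

      chain-Y-top : ∀ {t} zs → IsMaxChain _⊑_ (Y t) zs top → zs ≡ [ top ]
      chain-Y-top (w ∷ ws) (Y≺w , ch) with covering-last Y≺w iY≡m+2
      ... | refl = cong (top ∷_) (chain-top-top ws ch)

      chain-X-top : ∀ {s} zs → IsMaxChain _⊑_ (X s) zs top → Σ[ t ∈ Bool ] zs ≡ Y t ∷ [ top ]
      chain-X-top (w ∷ ws) (X≺w , ch) with covering-mid X≺w iX≡m+1 ≤-refl
      ... | t , j , refl , j≡m+2 with toℕ-injective (trans j≡m+2 (sym iY≡m+2))
      ... | refl = t , cong (Y t ∷_) (chain-Y-top ws ch)

      chain-under-X-top : ∀ {t₀} {i : Fin K} → toℕ i ≡ m →
        ∀ zs → IsMaxChain _⊑_ (mid c t₀ i) zs top →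
        Σ[ s ∈ Bool ] Σ[ t ∈ Bool ] zs ≡ X s ∷ Y t ∷ [ top ]
      chain-under-X-top i≡m (w ∷ ws) (i≺w , ch) with covering-mid i≺w i≡m (s≤s (s≤s (n≤1+n m)))
      ... | s , j , refl , j≡m+1 with toℕ-injective (trans j≡m+1 (sym iX≡m+1))
      ... | refl with chain-X-top ws ch
      ...   | t , refl = s , t , refl

      rising-from-X : ∀ s → Σ[ t ∈ Bool ] Rises (X s) (Y t) top
      rising-from-X s with R (X s) top tt (λ ())
      ... | zs , (ch , rs) , _ with chain-X-top zs ch
      ...   | t , refl = t , proj₁ rs

      g : Bool → Bool
      g s = proj₁ (rising-from-X s)

      g-rises : ∀ s → Rises (X s) (Y (g s)) top
      g-rises s = proj₂ (rising-from-X s)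

      g-unique : ∀ {s t} → Rises (X s) (Y t) top → t ≡ g s
      g-unique {s} r = side-injective (RisingVia-unique R tt (λ ())
        (RisingVia-twoStep X≺Y Y≺top r) (RisingVia-twoStep X≺Y Y≺top (g-rises s)))

      entry-into-X : ∀ s → Σ[ p ∈ P ] RisingVia bot p (X s)
      entry-into-X s = RisingVia-exists R tt (λ ())

      q : Bool → P
      q s = proj₁ (entry-into-X s)

      q-via : ∀ s → RisingVia bot (q s) (X s)
      q-via s = proj₂ (entry-into-X s)

      q≺X : ∀ s → Covers _⊑_ (q s) (X s)
      q≺X s = RisingVia⇒Covers (q-via s)

      rising-to-top : ∀ {s} → Rises (q s) (X s) (Y (g s)) → Σ[ t ∈ Bool ] RisingVia bot (Y t) top
      rising-to-top {s} r =
        g s , RisingVia-extend (RisingVia-extend (q-via s) X≺Y r) Y≺top (g-rises s)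

      rising-into-Y : ∀ t → Σ[ s ∈ Bool ] Rises (q s) (X s) (Y t)
      rising-into-Y t with RisingVia-exists R {b = Y t} tt (λ ())
      ... | p , via with covered-mid (RisingVia⇒Covers via) iY≡m+2
      ...   | s , j , refl , j≡m+1 with toℕ-injective (trans j≡m+1 (sym iX≡m+1))
      ...     | refl with RisingVia-restrict via (λ ())
      ...       | p′ , via′ , r with RisingVia-unique R tt (λ ()) via′ (q-via s)
      ...         | refl = s , r

      rising-over-X : ∀ {x s₀} → Covers _⊑_ x (X s₀) → Σ[ s ∈ Bool ] Rises x (X s) (Y (g s))
      rising-over-X x≺X with covered-mid x≺X iX≡m+1
      ... | t₀ , i , refl , i≡m with R (mid c t₀ i) top tt (λ ())
      ...   | zs , (ch , rs) , _ with chain-under-X-top i≡m zs ch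
      ...     | s , t , refl with rs
      ...       | r , r′ , _ = s , subst (λ t → Rises (mid c t₀ i) (X s) (Y t)) (g-unique r′) r

      X-unique-over : ∀ {x s₀ s s′ t} → Covers _⊑_ x (X s₀) →
        Rises x (X s) (Y t) → Rises x (X s′) (Y t) → s ≡ s′
      X-unique-over x≺X r r′ with covered-mid x≺X iX≡m+1
      ... | t₀ , i , refl , i≡m =
        side-injective (RisingVia-unique R (refl , inj₁ i<iY) (mid-≢ (<⇒≢ i<iY))
          (RisingVia-twoStep i≺X X≺Y r) (RisingVia-twoStep i≺X X≺Y r′))
        where
        i≺X : ∀ {s} → Covers _⊑_ (mid c t₀ i) (X s)
        i≺X = mid-covers (trans iX≡m+1 (cong suc (sym i≡m)))
        i<iY : toℕ i < toℕ iY
        i<iY = subst₂ _<_ (sym i≡m) (sym iY≡m+2) (s≤s (n≤1+n m))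

      rising-through-copy : ¬ ¬ (Σ[ t ∈ Bool ] RisingVia bot (Y t) top)
      rising-through-copy no-route with rising-into-Y (g false) | rising-over-X (q≺X true)
      ... | false , r | _          = no-route (rising-to-top r)
      ... | true  , _ | true  , r′ = no-route (rising-to-top r′)
      ... | true  , r | false , r′ = contradiction (X-unique-over (q≺X true) r r′) λ ()

    no-R-labeling : ⊥
    no-R-labeling =
      Copy.rising-through-copy true λ (_ , via) →
      Copy.rising-through-copy false λ (_ , via′) →
      contradiction (RisingVia-unique R tt (λ ()) via via′) λ ()

mainTheorem1 : (n : ℕ) → 4 ≤ n → (a b : Level) →
    ¬ HasRLabeling (_≤P_ {n}) a b
mainTheorem1 (suc (suc (suc (suc m)))) (s≤s (s≤s (s≤s (s≤s _)))) _ _ (_ , _∼_ , lab , R) =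
  Butterflies.RLabeled.no-R-labeling m _∼_ lab R
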